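{- Let $R$ be a commutative ring with identity, and let $\mathbf a\in\mathcal S(R)$ have an inverse $\mathbf b$ with respect to the Newton product. Then for every $n\ge0$, $$b_n=(-1)^n\sum_{t=0}^n\binom{n}{t}(-1)^t\frac{1}{\sum_{s=0}^t\binom{t}{s}a_s},$$ where $\frac{1}{\sum_{s=0}^t\binom{t}{s}a_s}$ denotes the inverse in $R$ of $\sum_{s=0}^t\binom{t}{s}a_s$.
   Context: $\mathcal S(R)$ is the set of sequences $(a_n)_{n\ge0}$ with $a_n\in R$. The Newton product is $(\mathbf a\boxtimes\mathbf b)_n=\sum_{i=0}^n\sum_{j=0}^i\binom{n}{i}\binom{i}{j}a_ib_{n-j}$; its identity element is $(1,0,0,\dots)$, and $\mathbf b$ is the inverse of $\mathbf a$ if $\mathbf a\boxtimes\mathbf b=(1,0,0,\dots)$. -}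

module Defs where

open import Level using (Level)
open import Data.Nat as ℕ using (ℕ; zero; suc)
open import Data.Nat.Combinatorics using (_C_)
open import Algebra.Bundles using (CommutativeRing)

module NewtonDefs {c ℓ : Level} (R : CommutativeRing c ℓ) where
  open CommutativeRing R hiding (zero)

  Seq : Set c
  Seq = ℕ → Carrier

  _·_ : ℕ → Carrier → Carrier
  zero  · x = 0#
  suc k · x = x + (k · x)

  sgn : ℕ → Carrier
  sgn zero    = 1#
  sgn (suc n) = - (sgn n)

  Σ≤ : ℕ → (ℕ → Carrier) → Carrier
  Σ≤ zero    f = f zero
  Σ≤ (suc n) f = Σ≤ n f + f (suc n)

  _⊠_ : Seq → Seq → Seq
  (a ⊠ b) n = Σ≤ n λ i → Σ≤ i λ j → ((n C i) ℕ.* (i C j)) · (a i * b (n ℕ.∸ j))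

  𝟙 : Seq
  𝟙 zero    = 1#
  𝟙 (suc _) = 0#

  IsInverse : Seq → Seq → Set ℓ
  IsInverse a b = ∀ n → (a ⊠ b) n ≈ 𝟙 n

  binT : Seq → Seq
  binT a t = Σ≤ t λ s → (t C s) · a s

{-# OPTIONS --safe #-}
-- The binomial transform B(a)ₜ = Σₛ C(t,s) aₛ turns the Newton product into the
-- pointwise product: B(a ⊠ b) = B(a) · B(b).  Both sides are proved equal by
-- induction on t, generalising over a and b, using Pascal's rule in the form
-- B(a)ₜ₊₁ = B(a)ₜ + B(Ea)ₜ, where (Ea)ᵢ = aᵢ₊₁, and the Leibniz-type rule
-- E(a ⊠ b) = a ⊠ Eb + Ea ⊠ Eb + Ea ⊠ b.  Hence B(a)ₜ · B(b)ₜ = B(𝟙)ₜ = 1, so B(b)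
-- inverts B(a) pointwise, and binomial inversion recovers b from B(b).
module Submission where

open import Defs
open import Level using (Level; _⊔_)
open import Data.Nat using (ℕ)
open import Data.Nat.Combinatorics using (_C_)
open import Data.Product using (Σ; _×_)
open import Algebra.Bundles using (CommutativeRing)

open import Data.Nat as ℕ using (zero; suc; _≤_; _∸_)
open import Data.Nat.Properties using (+-∸-assoc; ≤-refl; ≤-trans; m≤n⇒m≤1+n; n<1+n)
open import Data.Nat.Combinatorics using (nCk+nC[k+1]≡[n+1]C[k+1]; k>n⇒nCk≡0)
open import Data.Product using (_,_)
open import Data.Maybe using (nothing)
open import Relation.Binary.PropositionalEquality as ≡ using (_≡_)
import Tactic.RingSolver.Core.AlmostCommutativeRing as ACR
import Tactic.RingSolver.NonReflective as Solver

module BinomialTransform {c ℓ : Level} (R : CommutativeRing c ℓ) where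
  open CommutativeRing R hiding (zero)
  open NewtonDefs R
  open import Relation.Binary.Reasoning.Setoid setoid
  open import Algebra.Properties.Semiring.Mult semiring
    using (×-congʳ; ×-homo-+; ×-assocˡ; ×-comm-*) renaming (_×_ to _×ₙ_)
  open import Algebra.Properties.CommutativeMonoid.Mult +-commutativeMonoid
    using (×-distrib-+)
  open import Algebra.Properties.CommutativeSemigroup +-commutativeSemigroup
    using (interchange)
  open import Algebra.Properties.AbelianGroup +-abelianGroup using (⁻¹-∙-comm; ⁻¹-involutive; \\-leftDividesˡ)
  open import Algebra.Properties.Ring ring using (-1*x≈-x; -‿distribˡ-*; -‿distribʳ-*)
  open Solver (ACR.fromCommutativeRing R (λ _ → nothing)) using (solve; _⊜_; _⊕_; _⊗_)

  ·≡× : ∀ k x → k · x ≡ k ×ₙ x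
  ·≡× zero    x = ≡.refl
  ·≡× (suc k) x = ≡.cong (x +_) (·≡× k x)

  ·-congʳ : ∀ k {x y} → x ≈ y → k · x ≈ k · y
  ·-congʳ k {x} {y} x≈y rewrite ·≡× k x | ·≡× k y = ×-congʳ k x≈y

  ·-homo-+ : ∀ x m n → (m ℕ.+ n) · x ≈ m · x + n · x
  ·-homo-+ x m n rewrite ·≡× (m ℕ.+ n) x | ·≡× m x | ·≡× n x = ×-homo-+ x m n

  ·-assocˡ : ∀ x m n → m · (n · x) ≈ (m ℕ.* n) · x
  ·-assocˡ x m n rewrite ·≡× n x | ·≡× m (n ×ₙ x) | ·≡× (m ℕ.* n) x = ×-assocˡ x m n

  ·-distrib-+ : ∀ x y k → k · (x + y) ≈ k · x + k · y
  ·-distrib-+ x y k rewrite ·≡× k (x + y) | ·≡× k x | ·≡× k y = ×-distrib-+ x y k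

  ·-comm-* : ∀ k x y → x * (k · y) ≈ k · (x * y)
  ·-comm-* k x y rewrite ·≡× k y | ·≡× k (x * y) = ×-comm-* k x y

  Σ≤-cong-≤ : ∀ n {f g : ℕ → Carrier} → (∀ i → i ≤ n → f i ≈ g i) → Σ≤ n f ≈ Σ≤ n g
  Σ≤-cong-≤ zero    f≈g = f≈g 0 ℕ.z≤n
  Σ≤-cong-≤ (suc n) f≈g = +-cong (Σ≤-cong-≤ n (λ i i≤n → f≈g i (m≤n⇒m≤1+n i≤n))) (f≈g (suc n) ≤-refl)

  Σ≤-distrib-+ : ∀ n (f g : ℕ → Carrier) → Σ≤ n (λ i → f i + g i) ≈ Σ≤ n f + Σ≤ n g
  Σ≤-distrib-+ zero    f g = refl
  Σ≤-distrib-+ (suc n) f g = trans (+-cong (Σ≤-distrib-+ n f g) refl) (interchange _ _ _ _)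

  *-distribˡ-Σ≤ : ∀ x n (f : ℕ → Carrier) → x * Σ≤ n f ≈ Σ≤ n (λ i → x * f i)
  *-distribˡ-Σ≤ x zero    f = refl
  *-distribˡ-Σ≤ x (suc n) f = trans (distribˡ x _ _) (+-cong (*-distribˡ-Σ≤ x n f) refl)

  ·-distrib-Σ≤ : ∀ k n (f : ℕ → Carrier) → k · Σ≤ n f ≈ Σ≤ n (λ i → k · f i)
  ·-distrib-Σ≤ k zero    f = refl
  ·-distrib-Σ≤ k (suc n) f = trans (·-distrib-+ _ _ k) (+-cong (·-distrib-Σ≤ k n f) refl)

  Σ≤-head : ∀ n (f : ℕ → Carrier) → Σ≤ (suc n) f ≈ f 0 + Σ≤ n (λ i → f (suc i))
  Σ≤-head zero    f = refl
  Σ≤-head (suc n) f = trans (+-cong (Σ≤-head n f) refl) (+-assoc _ _ _)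

  shift : Seq → Seq
  shift a i = a (suc i)

  binT-cong-≤ : ∀ t {a a′ : Seq} → (∀ i → i ≤ t → a i ≈ a′ i) → binT a t ≈ binT a′ t
  binT-cong-≤ t a≈a′ = Σ≤-cong-≤ t (λ i i≤t → ·-congʳ (t C i) (a≈a′ i i≤t))

  binT-cong : ∀ t {a a′ : Seq} → (∀ i → a i ≈ a′ i) → binT a t ≈ binT a′ t
  binT-cong t a≈a′ = binT-cong-≤ t (λ i _ → a≈a′ i)

  binT-zero : ∀ a → binT a 0 ≈ a 0
  binT-zero a = +-identityʳ (a 0)

  binT-+ : ∀ t (a a′ : Seq) → binT (λ i → a i + a′ i) t ≈ binT a t + binT a′ t
  binT-+ t a a′ = trans (Σ≤-cong-≤ t (λ i _ → ·-distrib-+ _ _ (t C i))) (Σ≤-distrib-+ t _ _)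

  binT-*ˡ : ∀ x t (a : Seq) → binT (λ i → x * a i) t ≈ x * binT a t
  binT-*ˡ x t a = sym (trans (*-distribˡ-Σ≤ x t _) (Σ≤-cong-≤ t (λ i _ → ·-comm-* (t C i) x (a i))))

  binT-suc : ∀ t (a : Seq) → binT a (suc t) ≈ binT a t + binT (shift a) t
  binT-suc t a = begin
    binT a (suc t)
      ≈⟨ Σ≤-head t _ ⟩
    (t C 0) · a 0 + Σ≤ t (λ i → (suc t C suc i) · a (suc i))
      ≈⟨ +-congˡ (Σ≤-cong-≤ t (λ i _ → pascal i)) ⟩
    (t C 0) · a 0 + Σ≤ t (λ i → (t C i) · a (suc i) + (t C suc i) · a (suc i))
      ≈⟨ +-congˡ (Σ≤-distrib-+ t _ _) ⟩
    (t C 0) · a 0 + (binT (shift a) t + Σ≤ t (λ i → (t C suc i) · a (suc i)))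
      ≈⟨ solve 3 (λ x y z → (x ⊕ (y ⊕ z)) ⊜ ((x ⊕ z) ⊕ y)) refl _ _ _ ⟩
    ((t C 0) · a 0 + Σ≤ t (λ i → (t C suc i) · a (suc i))) + binT (shift a) t
      ≈⟨ +-congʳ (sym (Σ≤-head t _)) ⟩
    (binT a t + (t C suc t) · a (suc t)) + binT (shift a) t
      ≈⟨ +-congʳ (trans (+-congˡ (reflexive (≡.cong (_· a (suc t)) (k>n⇒nCk≡0 (n<1+n t))))) (+-identityʳ _)) ⟩
    binT a t + binT (shift a) t ∎
    where
    pascal : ∀ i → (suc t C suc i) · a (suc i) ≈ (t C i) · a (suc i) + (t C suc i) · a (suc i)
    pascal i = trans (reflexive (≡.cong (_· a (suc i)) (≡.sym (nCk+nC[k+1]≡[n+1]C[k+1] t i))))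
                     (·-homo-+ (a (suc i)) (t C i) (t C suc i))

  _⊠′_ : Seq → Seq → Seq
  (a ⊠′ b) n = binT (λ i → binT (λ j → a i * b (n ∸ j)) i) n

  ⊠≈⊠′ : ∀ a b n → (a ⊠ b) n ≈ (a ⊠′ b) n
  ⊠≈⊠′ a b n = Σ≤-cong-≤ n (λ i _ →
    trans (Σ≤-cong-≤ i (λ j _ → sym (·-assocˡ _ (n C i) (i C j)))) (sym (·-distrib-Σ≤ (n C i) i _)))

  binT-∸-suc : ∀ (f : ℕ → Carrier) {i n} → i ≤ n →
               binT (λ j → f (suc n ∸ j)) i ≈ binT (λ j → f (suc (n ∸ j))) i
  binT-∸-suc f i≤n = binT-cong-≤ _ (λ j j≤i → reflexive (≡.cong f (+-∸-assoc 1 (≤-trans j≤i i≤n))))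

  ⊠′-suc : ∀ a b n → (a ⊠′ b) (suc n) ≈ (a ⊠′ shift b) n + ((shift a ⊠′ shift b) n + (shift a ⊠′ b) n)
  ⊠′-suc a b n = begin
    binT inner (suc n)
      ≈⟨ binT-suc n inner ⟩
    binT inner n + binT (shift inner) n
      ≈⟨ +-cong (binT-cong-≤ n (λ i i≤n → binT-∸-suc (λ k → a i * b k) i≤n))
                (binT-cong-≤ n (λ i i≤n → binT-suc i _)) ⟩
    (a ⊠′ shift b) n + binT (λ i → binT (λ j → a (suc i) * b (suc n ∸ j)) i
                                 + binT (λ j → a (suc i) * b (n ∸ j)) i) n
      ≈⟨ +-congˡ (binT-+ n _ _) ⟩
    (a ⊠′ shift b) n + (binT (λ i → binT (λ j → a (suc i) * b (suc n ∸ j)) i) n + (shift a ⊠′ b) n)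
      ≈⟨ +-congˡ (+-congʳ (binT-cong-≤ n (λ i i≤n → binT-∸-suc (λ k → a (suc i) * b k) i≤n))) ⟩
    (a ⊠′ shift b) n + ((shift a ⊠′ shift b) n + (shift a ⊠′ b) n) ∎
    where
    inner : Seq
    inner i = binT (λ j → a i * b (suc n ∸ j)) i

  binT-⊠′ : ∀ t a b → binT (a ⊠′ b) t ≈ binT a t * binT b t
  binT-⊠′ zero a b =
    trans (binT-zero (a ⊠′ b))
      (trans (binT-zero (λ i → binT (λ j → a i * b (0 ∸ j)) i))
        (trans (binT-zero (λ j → a 0 * b (0 ∸ j))) (sym (*-cong (binT-zero a) (binT-zero b)))))
  binT-⊠′ (suc t) a b = begin
    binT (a ⊠′ b) (suc t)
      ≈⟨ binT-suc t (a ⊠′ b) ⟩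
    binT (a ⊠′ b) t + binT (shift (a ⊠′ b)) t
      ≈⟨ +-congˡ (trans (binT-cong t (⊠′-suc a b)) (trans (binT-+ t _ _) (+-congˡ (binT-+ t _ _)))) ⟩
    binT (a ⊠′ b) t + (binT (a ⊠′ shift b) t + (binT (shift a ⊠′ shift b) t + binT (shift a ⊠′ b) t))
      ≈⟨ +-cong (binT-⊠′ t a b) (+-cong (binT-⊠′ t a (shift b))
                                 (+-cong (binT-⊠′ t (shift a) (shift b)) (binT-⊠′ t (shift a) b))) ⟩
    A * B + (A * B′ + (A′ * B′ + A′ * B))
      ≈⟨ solve 4 (λ A A′ B B′ → (A ⊗ B ⊕ (A ⊗ B′ ⊕ (A′ ⊗ B′ ⊕ A′ ⊗ B))) ⊜ ((A ⊕ A′) ⊗ (B ⊕ B′))) refl A A′ B B′ ⟩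
    (A + A′) * (B + B′)
      ≈⟨ sym (*-cong (binT-suc t a) (binT-suc t b)) ⟩
    binT a (suc t) * binT b (suc t) ∎
    where
    A = binT a t
    A′ = binT (shift a) t
    B = binT b t
    B′ = binT (shift b) t

  binT-⊠ : ∀ t a b → binT (a ⊠ b) t ≈ binT a t * binT b t
  binT-⊠ t a b = trans (binT-cong t (⊠≈⊠′ a b)) (binT-⊠′ t a b)

  binT-𝟙 : ∀ t → binT 𝟙 t ≈ 1#
  binT-𝟙 zero    = binT-zero 𝟙
  binT-𝟙 (suc t) = trans (binT-suc t 𝟙) (trans (+-cong (binT-𝟙 t) binT-0#) (+-identityʳ 1#))
    where
    binT-0# : binT (λ _ → 0#) t ≈ 0#
    binT-0# = trans (binT-cong t (λ _ → sym (zeroˡ 0#))) (trans (binT-*ˡ 0# t _) (zeroˡ _))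

  alternate : Seq → Seq
  alternate a t = sgn t * a t

  binT-alternate-suc : ∀ n a → binT (alternate a) (suc n) ≈ binT (alternate a) n - binT (alternate (shift a)) n
  binT-alternate-suc n a = trans (binT-suc n (alternate a)) (+-congˡ (begin
    binT (shift (alternate a)) n
      ≈⟨ binT-cong n (λ t → trans (sym (-‿distribˡ-* (sgn t) _)) (sym (-1*x≈-x _))) ⟩
    binT (λ t → - 1# * alternate (shift a) t) n
      ≈⟨ binT-*ˡ (- 1#) n _ ⟩
    - 1# * binT (alternate (shift a)) n
      ≈⟨ -1*x≈-x _ ⟩
    - binT (alternate (shift a)) n ∎))

  binT-alternate-binT-suc : ∀ n b →
    binT (alternate (binT b)) (suc n) ≈ - binT (alternate (binT (shift b))) n
  binT-alternate-binT-suc n b = begin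
    binT (alternate (binT b)) (suc n)
      ≈⟨ binT-alternate-suc n (binT b) ⟩
    X - binT (alternate (shift (binT b))) n
      ≈⟨ +-congˡ (-‿cong (binT-cong n (λ t → *-congˡ (binT-suc t b)))) ⟩
    X - binT (λ t → sgn t * (binT b t + binT (shift b) t)) n
      ≈⟨ +-congˡ (-‿cong (trans (binT-cong n (λ t → distribˡ (sgn t) _ _)) (binT-+ n _ _))) ⟩
    X - (X + Y)
      ≈⟨ +-congˡ (sym (⁻¹-∙-comm X Y)) ⟩
    X + (- X - Y)
      ≈⟨ \\-leftDividesˡ X (- Y) ⟩
    - Y ∎
    where
    X = binT (alternate (binT b)) n
    Y = binT (alternate (binT (shift b))) n

  binomial-inversion : ∀ n b → b n ≈ sgn n * binT (alternate (binT b)) n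
  binomial-inversion zero b =
    sym (trans (*-identityˡ _) (trans (binT-zero (alternate (binT b))) (trans (*-identityˡ _) (binT-zero b))))
  binomial-inversion (suc n) b = begin
    b (suc n)
      ≈⟨ binomial-inversion n (shift b) ⟩
    sgn n * binT (alternate (binT (shift b))) n
      ≈⟨ sym (neg*neg _ _) ⟩
    - sgn n * - binT (alternate (binT (shift b))) n
      ≈⟨ *-congˡ (sym (binT-alternate-binT-suc n b)) ⟩
    sgn (suc n) * binT (alternate (binT b)) (suc n) ∎
    where
    neg*neg : ∀ x y → - x * - y ≈ x * y
    neg*neg x y = trans (sym (-‿distribˡ-* x (- y))) (trans (-‿cong (sym (-‿distribʳ-* x y))) (⁻¹-involutive _))

proposition10 : {c ℓ : Level} (R : CommutativeRing c ℓ) →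
  let open CommutativeRing R
      open NewtonDefs R
  in (a b : Seq) → IsInverse a b →
     Σ (ℕ → Carrier) λ inv →
       (∀ t → binT a t * inv t ≈ 1#) ×
       (∀ n → b n ≈ sgn n * Σ≤ n (λ t → (n C t) · (sgn t * inv t)))
proposition10 R a b a⊠b≈𝟙 =
  binT b ,
  (λ t → trans (sym (binT-⊠ t a b)) (trans (binT-cong t a⊠b≈𝟙) (binT-𝟙 t))) ,
  (λ n → binomial-inversion n b)
  where
  open CommutativeRing R using (trans; sym)
  open NewtonDefs R using (binT)
  open BinomialTransform R
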